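{- Let $P$ be a finite set of propositions, $\Pi=2^P$, $\pi\in\Pi^*$ a finite trace, $\phi$ a formula of the LTL fragment described in the context, and $i\in\mathbb{N}_{>0}$ an index. Then $d_\pi(\phi,i)$ is of one of the forms $(a,-)$, $(-,a)$, $(b_1,b_2)$, $(b_1,\infty)$, $(\infty,b_2)$ or $(\infty,\infty)$, where $a,b_1,b_2\in\mathbb{N}_0$, $a\le|\pi|-i$ and $b_j>|\pi|-i$ for $j\in\{1,2\}$.
   Context: A trace $\pi=\pi_1\pi_2\dots\pi_{|\pi|}$ is a finite sequence over $\Pi$. Formulas: $\phi ::= p \mid \neg\phi \mid \phi_1\vee\phi_2 \mid \mathbf{X}\phi \mid \phi_1\,\mathbf{U}\,\phi_2 \mid \mathbf{F}\phi$, $p\in P$. Let $\mathbb{N}_+=\mathbb{N}_0\cup\{\infty,-\}$ with order $n<\infty<-$ for all $n\in\mathbb{N}_0$ ($\infty$ = "infinite", $-$ = "impossible"). Define $a\oplus b=a+b$ if $a,b\in\mathbb{N}_0$ and $\max\{a,b\}$ otherwise. On pairs: $\mathrm{swap}(s,f)=(f,s)$; $(s,f)\oplus1=(s\oplus1,f\oplus1)$; $(s,f)\sqcup(s',f')=(\min(s,s'),\max(f,f'))$; $(s,f)\sqcap(s',f')=(\max(s,s'),\min(f,f'))$. Counting semantics $d_\pi(\phi,i)\in\mathbb{N}_+\times\mathbb{N}_+$ for $i\in\mathbb{N}_{>0}$: $d_\pi(p,i)=(0,-)$ if $i\le|\pi|$ and $p\in\pi_i$; $=(-,0)$ if $i\le|\pi|$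 and $p\notin\pi_i$; $=(0,0)$ if $i>|\pi|$. $d_\pi(\neg\phi,i)=\mathrm{swap}\,d_\pi(\phi,i)$; $d_\pi(\phi_1\vee\phi_2,i)=d_\pi(\phi_1,i)\sqcup d_\pi(\phi_2,i)$; $d_\pi(\mathbf{X}\phi,i)=d_\pi(\phi,i+1)\oplus1$. $d_\pi(\phi\mathbf{U}\psi,i)=d_\pi(\psi,i)\sqcup\big(d_\pi(\phi,i)\sqcap d_\pi(\mathbf{X}(\phi\mathbf{U}\psi),i)\big)$ if $i\le|\pi|$, and $=d_\pi(\psi,i)\sqcup\big(d_\pi(\phi,i)\sqcap(-,\infty)\big)$ if $i>|\pi|$. $d_\pi(\mathbf{F}\phi,i)=d_\pi(\phi,i)\sqcup d_\pi(\mathbf{X}\mathbf{F}\phi,i)$ if $i\le|\pi|$, and $=d_\pi(\phi,i)\sqcup(-,\infty)$ if $i>|\pi|$. -}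

module Defs where

open import Data.Nat using (ℕ; zero; suc; _+_; _∸_; _≤_; _<_; _≤ᵇ_)
open import Data.Nat.Base using (_⊔_; _⊓_)
open import Data.Bool using (Bool; true; false; if_then_else_)
open import Data.Fin using (Fin)
open import Data.Vec using (Vec; lookup)
open import Data.List using (List; []; _∷_; length)
open import Data.Product using (_×_; _,_)

-- ℕ₊ = ℕ₀ ∪ {∞, -} with order n < ∞ < -
data ℕ₊ : Set where
  fin : ℕ → ℕ₊
  ∞   : ℕ₊
  imp : ℕ₊          -- "−" (impossible)

_⊕_ : ℕ₊ → ℕ₊ → ℕ₊
fin a ⊕ fin b = fin (a + b)
fin a ⊕ y     = y
∞     ⊕ fin b = ∞
∞     ⊕ ∞     = ∞
∞     ⊕ imp   = imp
imp   ⊕ y     = imp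

max₊ : ℕ₊ → ℕ₊ → ℕ₊
max₊ (fin a) (fin b) = fin (a ⊔ b)
max₊ (fin a) y       = y
max₊ ∞       (fin b) = ∞
max₊ ∞       y       = y
max₊ imp     y       = imp

min₊ : ℕ₊ → ℕ₊ → ℕ₊
min₊ (fin a) (fin b) = fin (a ⊓ b)
min₊ (fin a) y       = fin a
min₊ ∞       (fin b) = fin b
min₊ ∞       y       = ∞
min₊ imp     y       = y

Pair : Set
Pair = ℕ₊ × ℕ₊

swap : Pair → Pair
swap (s , f) = (f , s)

_⊕1 : Pair → Pair
(s , f) ⊕1 = (s ⊕ fin 1 , f ⊕ fin 1)

_⊔ₚ_ : Pair → Pair → Pair
(s , f) ⊔ₚ (s' , f') = (min₊ s s' , max₊ f f')

_⊓ₚ_ : Pair → Pair → Pair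
(s , f) ⊓ₚ (s' , f') = (max₊ s s' , min₊ f f')

-- Propositions P = Fin m; letters Π = 2^P as Vec Bool m (characteristic vectors)
Letter : ℕ → Set
Letter m = Vec Bool m

Trace : ℕ → Set
Trace m = List (Letter m)

data Formula (m : ℕ) : Set where
  prop : Fin m → Formula m
  ¬_   : Formula m → Formula m
  _∨_  : Formula m → Formula m → Formula m
  X_   : Formula m → Formula m
  _U_  : Formula m → Formula m → Formula m
  F_   : Formula m → Formula m

-- d_π(p,i), positions are 1-based; i = 0 never occurs for i > 0 and gets a junk value
atomVal : ∀ {m} → Trace m → ℕ → Fin m → Pair
atomVal []       i             p = (fin 0 , fin 0)
atomVal (x ∷ xs) zero          p = (fin 0 , fin 0)
atomVal (x ∷ xs) (suc zero)    p = if lookup x p then (fin 0 , imp) else (imp , fin 0)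
atomVal (x ∷ xs) (suc (suc i)) p = atomVal xs (suc i) p

-- Unfolding of the U recursion: with k = (|π|+1) ∸ i steps remaining,
-- k = 0 exactly when i > |π| (base clause), otherwise unfold one step to i+1.
untilAux : (ℕ → Pair) → (ℕ → Pair) → ℕ → ℕ → Pair
untilAux f g zero    i = g i ⊔ₚ (f i ⊓ₚ (imp , ∞))
untilAux f g (suc k) i = g i ⊔ₚ (f i ⊓ₚ (untilAux f g k (suc i) ⊕1))

eventAux : (ℕ → Pair) → ℕ → ℕ → Pair
eventAux f zero    i = f i ⊔ₚ (imp , ∞)
eventAux f (suc k) i = f i ⊔ₚ (eventAux f k (suc i) ⊕1)

d : ∀ {m} → Trace m → Formula m → ℕ → Pair
d π (prop p) i = atomVal π i p
d π (¬ φ)    i = swap (d π φ i)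
d π (φ ∨ ψ)  i = d π φ i ⊔ₚ d π ψ i
d π (X φ)    i = d π φ (suc i) ⊕1
d π (φ U ψ)  i = untilAux (d π φ) (d π ψ) (suc (length π) ∸ i) i
d π (F φ)    i = eventAux (d π φ) (suc (length π) ∸ i) i

-- Call a component value a + i ≤ |π| "inside" and a value with |π| < b + i, or ∞,
-- "beyond"; the theorem says d_π(φ, i) is (inside, −), (−, inside) or (beyond, beyond).
-- Since inside < beyond < − in ℕ₊, this shape is preserved by swap, ⊔ₚ and ⊓ₚ at a fixed
-- position, and ⊕1 carries it from position i + 1 to position i; atoms have it, so it
-- holds for every formula by induction, unfolding U and F along the trace. Past the end
-- of the trace both components are beyond, and against such values the − in the base pair
-- (−, ∞) of U and F behaves exactly like ∞, so the base cases reduce to the pair (∞, ∞).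
module Submission where

open import Defs
open import Data.Nat using (ℕ; zero; suc; pred; _+_; _∸_; _≤_; _<_; z≤n; s≤s)
open import Data.Nat.Properties
open import Data.Bool using (true; false)
open import Data.Vec using (lookup)
open import Data.List using ([]; _∷_; length)
open import Data.Product using (_×_; _,_; proj₁; ∃-syntax)
open import Data.Sum using (_⊎_; inj₁; inj₂)
open import Data.Empty using (⊥-elim)
open import Relation.Binary.PropositionalEquality
  using (_≡_; refl; sym; trans; cong; subst)

data Inside (n i : ℕ) : ℕ₊ → Set where
  inside : ∀ {a} → a + i ≤ n → Inside n i (fin a)

data Beyond (n i : ℕ) : ℕ₊ → Set where
  beyond   : ∀ {b} → n < b + i → Beyond n i (fin b)
  beyond-∞ : Beyond n i ∞

data Admissible (n i : ℕ) : Pair → Set where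
  satisfied : ∀ {x} → Inside n i x → Admissible n i (x , imp)
  violated  : ∀ {y} → Inside n i y → Admissible n i (imp , y)
  pending   : ∀ {x y} → Beyond n i x → Beyond n i y → Admissible n i (x , y)

min₊-identityʳ : ∀ x → min₊ x imp ≡ x
min₊-identityʳ (fin a) = refl
min₊-identityʳ ∞       = refl
min₊-identityʳ imp     = refl

max₊-zeroʳ : ∀ x → max₊ x imp ≡ imp
max₊-zeroʳ (fin a) = refl
max₊-zeroʳ ∞       = refl
max₊-zeroʳ imp     = refl

module _ {n i : ℕ} where

  min₊-insideˡ : ∀ {x} y → Inside n i x → Inside n i (min₊ x y)
  min₊-insideˡ (fin b) (inside {a} h) = inside (≤-trans (+-monoˡ-≤ i (m⊓n≤m a b)) h)
  min₊-insideˡ ∞       (inside h)     = inside h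
  min₊-insideˡ imp     (inside h)     = inside h

  min₊-insideʳ : ∀ x {y} → Inside n i y → Inside n i (min₊ x y)
  min₊-insideʳ (fin a) (inside {b} h) = inside (≤-trans (+-monoˡ-≤ i (m⊓n≤n a b)) h)
  min₊-insideʳ ∞       (inside h)     = inside h
  min₊-insideʳ imp     (inside h)     = inside h

  min₊-beyond : ∀ {x y} → Beyond n i x → Beyond n i y → Beyond n i (min₊ x y)
  min₊-beyond (beyond {a} h) (beyond {b} h′) =
    beyond (subst (n <_) (sym (+-distribʳ-⊓ i a b)) (⊓-glb h h′))
  min₊-beyond (beyond h) beyond-∞   = beyond h
  min₊-beyond beyond-∞   (beyond h) = beyond h
  min₊-beyond beyond-∞   beyond-∞   = beyond-∞

  max₊-inside : ∀ {x y} → Inside n i x → Inside n i y → Inside n i (max₊ x y)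
  max₊-inside (inside {a} h) (inside {b} h′) =
    inside (subst (_≤ n) (sym (+-distribʳ-⊔ i a b)) (⊔-lub h h′))

  max₊-beyondˡ : ∀ {x y} → Beyond n i x → Inside n i y → Beyond n i (max₊ x y)
  max₊-beyondˡ (beyond {a} h) (inside {b} _) = beyond (<-≤-trans h (+-monoˡ-≤ i (m≤m⊔n a b)))
  max₊-beyondˡ beyond-∞       (inside _)     = beyond-∞

  max₊-beyondʳ : ∀ {x y} → Inside n i x → Beyond n i y → Beyond n i (max₊ x y)
  max₊-beyondʳ (inside {a} _) (beyond {b} h) = beyond (<-≤-trans h (+-monoˡ-≤ i (m≤n⊔m a b)))
  max₊-beyondʳ (inside _)     beyond-∞       = beyond-∞

  max₊-beyond : ∀ {x y} → Beyond n i x → Beyond n i y → Beyond n i (max₊ x y)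
  max₊-beyond (beyond {a} h) (beyond {b} _) = beyond (<-≤-trans h (+-monoˡ-≤ i (m≤m⊔n a b)))
  max₊-beyond (beyond _)     beyond-∞       = beyond-∞
  max₊-beyond beyond-∞       (beyond _)     = beyond-∞
  max₊-beyond beyond-∞       beyond-∞       = beyond-∞

  swap-admissible : ∀ {p} → Admissible n i p → Admissible n i (swap p)
  swap-admissible (satisfied x) = violated x
  swap-admissible (violated y)  = satisfied y
  swap-admissible (pending x y) = pending y x

  ⊔ₚ-admissible : ∀ {p q} → Admissible n i p → Admissible n i q → Admissible n i (p ⊔ₚ q)
  ⊔ₚ-admissible (satisfied x) (satisfied y) = satisfied (min₊-insideˡ _ x)
  ⊔ₚ-admissible (satisfied x) (violated y)  = satisfied (min₊-insideˡ _ x)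
  ⊔ₚ-admissible (satisfied x) (pending y z) = satisfied (min₊-insideˡ _ x)
  ⊔ₚ-admissible (violated {x} _) (satisfied y) rewrite max₊-zeroʳ x = satisfied y
  ⊔ₚ-admissible (violated x) (violated y)  = violated (max₊-inside x y)
  ⊔ₚ-admissible (violated x) (pending y z) = pending y (max₊-beyondʳ x z)
  ⊔ₚ-admissible (pending {_} {x₂} _ _) (satisfied y) rewrite max₊-zeroʳ x₂ =
    satisfied (min₊-insideʳ _ y)
  ⊔ₚ-admissible (pending {x₁} b₁ b₂) (violated y) rewrite min₊-identityʳ x₁ =
    pending b₁ (max₊-beyondˡ b₂ y)
  ⊔ₚ-admissible (pending x₁ x₂) (pending y₁ y₂) = pending (min₊-beyond x₁ y₁) (max₊-beyond x₂ y₂)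

  ⊓ₚ-admissible : ∀ {p q} → Admissible n i p → Admissible n i q → Admissible n i (p ⊓ₚ q)
  ⊓ₚ-admissible p q = swap-admissible (⊔ₚ-admissible (swap-admissible p) (swap-admissible q))

  beyond-past-end : ∀ {p} → n < i → Admissible n i p → Beyond n i (proj₁ p)
  beyond-past-end n<i (satisfied (inside {a} h)) = ⊥-elim (<⇒≱ n<i (≤-trans (m≤n+m i a) h))
  beyond-past-end n<i (violated (inside {a} h))  = ⊥-elim (<⇒≱ n<i (≤-trans (m≤n+m i a) h))
  beyond-past-end _   (pending x _)              = x

  ⊔ₚ-∞≡⊔ₚ-imp : ∀ p y → Beyond n i (proj₁ p) → p ⊔ₚ (∞ , y) ≡ p ⊔ₚ (imp , y)
  ⊔ₚ-∞≡⊔ₚ-imp _ _ (beyond _) = refl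
  ⊔ₚ-∞≡⊔ₚ-imp _ _ beyond-∞   = refl

  ⊔ₚ-⊓ₚ-∞≡⊔ₚ-⊓ₚ-imp : ∀ p q y → Beyond n i (proj₁ p) → Beyond n i (proj₁ q) →
    p ⊔ₚ (q ⊓ₚ (∞ , y)) ≡ p ⊔ₚ (q ⊓ₚ (imp , y))
  ⊔ₚ-⊓ₚ-∞≡⊔ₚ-⊓ₚ-imp p (_ , q₂) y p₁ (beyond _) = ⊔ₚ-∞≡⊔ₚ-imp p (min₊ q₂ y) p₁
  ⊔ₚ-⊓ₚ-∞≡⊔ₚ-⊓ₚ-imp p (_ , q₂) y p₁ beyond-∞   = ⊔ₚ-∞≡⊔ₚ-imp p (min₊ q₂ y) p₁

inside-⊕1 : ∀ {n i x} → Inside n (suc i) x → Inside n i (x ⊕ fin 1)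
inside-⊕1 {n} {i} (inside {a} h) = inside (subst (_≤ n) (sym (+-assoc a 1 i)) h)

beyond-⊕1 : ∀ {n i x} → Beyond n (suc i) x → Beyond n i (x ⊕ fin 1)
beyond-⊕1 {n} {i} (beyond {b} h) = beyond (subst (n <_) (sym (+-assoc b 1 i)) h)
beyond-⊕1 beyond-∞ = beyond-∞

⊕1-admissible : ∀ {n i p} → Admissible n (suc i) p → Admissible n i (p ⊕1)
⊕1-admissible (satisfied x) = satisfied (inside-⊕1 x)
⊕1-admissible (violated y)  = violated (inside-⊕1 y)
⊕1-admissible (pending x y) = pending (beyond-⊕1 x) (beyond-⊕1 y)

inside-suc : ∀ {n i x} → Inside n i x → Inside (suc n) (suc i) x
inside-suc {n} {i} (inside {a} h) = inside (subst (_≤ suc n) (sym (+-suc a i)) (s≤s h))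

beyond-suc : ∀ {n i x} → Beyond n i x → Beyond (suc n) (suc i) x
beyond-suc {n} {i} (beyond {b} h) = beyond (subst (suc n <_) (sym (+-suc b i)) (s≤s h))
beyond-suc beyond-∞ = beyond-∞

admissible-suc : ∀ {n i p} → Admissible n i p → Admissible (suc n) (suc i) p
admissible-suc (satisfied x) = satisfied (inside-suc x)
admissible-suc (violated y)  = violated (inside-suc y)
admissible-suc (pending x y) = pending (beyond-suc x) (beyond-suc y)

atomVal-admissible : ∀ {m} (π : Trace m) j p → Admissible (length π) (suc j) (atomVal π (suc j) p)
atomVal-admissible []       j p = pending (beyond (s≤s z≤n)) (beyond (s≤s z≤n))
atomVal-admissible (x ∷ xs) zero p with lookup x p
... | true  = satisfied (inside (s≤s z≤n))
... | false = violated (inside (s≤s z≤n))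
atomVal-admissible (x ∷ xs) (suc j) p = admissible-suc (atomVal-admissible xs j p)

remaining-suc : ∀ {k} n j → suc k ≡ n ∸ j → k ≡ n ∸ suc j
remaining-suc n j e = trans (cong pred e) (pred[m∸n]≡m∸[1+n] n j)

past-end : ∀ n j → 0 ≡ n ∸ j → n < suc j
past-end n j e = s≤s (m∸n≡0⇒m≤n (sym e))

-- At position suc j the unfoldings of U and F in d start with k = suc n ∸ suc j = n ∸ j.
module _ {n : ℕ} {f : ℕ → Pair} (f-admissible : ∀ j → Admissible n (suc j) (f (suc j))) where

  untilAux-admissible : ∀ {g : ℕ → Pair} → (∀ j → Admissible n (suc j) (g (suc j))) →
    ∀ k j → k ≡ n ∸ j → Admissible n (suc j) (untilAux f g k (suc j))
  untilAux-admissible {g} g-admissible zero j e =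
    subst (Admissible n (suc j))
      (⊔ₚ-⊓ₚ-∞≡⊔ₚ-⊓ₚ-imp (g (suc j)) (f (suc j)) ∞
        (beyond-past-end n<i (g-admissible j)) (beyond-past-end n<i (f-admissible j)))
      (⊔ₚ-admissible (g-admissible j) (⊓ₚ-admissible (f-admissible j) (pending beyond-∞ beyond-∞)))
    where n<i = past-end n j e
  untilAux-admissible g-admissible (suc k) j e =
    ⊔ₚ-admissible (g-admissible j) (⊓ₚ-admissible (f-admissible j)
      (⊕1-admissible (untilAux-admissible g-admissible k (suc j) (remaining-suc n j e))))

  eventAux-admissible : ∀ k j → k ≡ n ∸ j → Admissible n (suc j) (eventAux f k (suc j))
  eventAux-admissible zero j e =
    subst (Admissible n (suc j))
      (⊔ₚ-∞≡⊔ₚ-imp (f (suc j)) ∞ (beyond-past-end (past-end n j e) (f-admissible j)))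
      (⊔ₚ-admissible (f-admissible j) (pending beyond-∞ beyond-∞))
  eventAux-admissible (suc k) j e =
    ⊔ₚ-admissible (f-admissible j) (⊕1-admissible (eventAux-admissible k (suc j) (remaining-suc n j e)))

d-admissible : ∀ {m} (π : Trace m) φ j → Admissible (length π) (suc j) (d π φ (suc j))
d-admissible π (prop p) j = atomVal-admissible π j p
d-admissible π (¬ φ)    j = swap-admissible (d-admissible π φ j)
d-admissible π (φ ∨ ψ)  j = ⊔ₚ-admissible (d-admissible π φ j) (d-admissible π ψ j)
d-admissible π (X φ)    j = ⊕1-admissible (d-admissible π φ (suc j))
d-admissible π (φ U ψ)  j = untilAux-admissible (d-admissible π φ) (d-admissible π ψ) _ j refl
d-admissible π (F φ)    j = eventAux-admissible (d-admissible π φ) _ j refl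

admissible-cases : ∀ {n i p} → Admissible n i p →
    (∃[ a ] (p ≡ (fin a , imp) × a + i ≤ n))
    ⊎ (∃[ a ] (p ≡ (imp , fin a) × a + i ≤ n))
    ⊎ (∃[ b₁ ] ∃[ b₂ ] (p ≡ (fin b₁ , fin b₂) × n < b₁ + i × n < b₂ + i))
    ⊎ (∃[ b₁ ] (p ≡ (fin b₁ , ∞) × n < b₁ + i))
    ⊎ (∃[ b₂ ] (p ≡ (∞ , fin b₂) × n < b₂ + i))
    ⊎ (p ≡ (∞ , ∞))
admissible-cases (satisfied (inside h))           = inj₁ (_ , refl , h)
admissible-cases (violated (inside h))            = inj₂ (inj₁ (_ , refl , h))
admissible-cases (pending (beyond h) (beyond h′)) = inj₂ (inj₂ (inj₁ (_ , _ , refl , h , h′)))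
admissible-cases (pending (beyond h) beyond-∞)    = inj₂ (inj₂ (inj₂ (inj₁ (_ , refl , h))))
admissible-cases (pending beyond-∞ (beyond h))    = inj₂ (inj₂ (inj₂ (inj₂ (inj₁ (_ , refl , h)))))
admissible-cases (pending beyond-∞ beyond-∞)      = inj₂ (inj₂ (inj₂ (inj₂ (inj₂ refl))))

lemma2 : ∀ {m} (π : Trace m) (φ : Formula m) (i : ℕ) → 1 ≤ i →
    (∃[ a ] (d π φ i ≡ (fin a , imp) × a + i ≤ length π))
    ⊎ (∃[ a ] (d π φ i ≡ (imp , fin a) × a + i ≤ length π))
    ⊎ (∃[ b₁ ] ∃[ b₂ ] (d π φ i ≡ (fin b₁ , fin b₂) × length π < b₁ + i × length π < b₂ + i))
    ⊎ (∃[ b₁ ] (d π φ i ≡ (fin b₁ , ∞) × length π < b₁ + i))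
    ⊎ (∃[ b₂ ] (d π φ i ≡ (∞ , fin b₂) × length π < b₂ + i))
    ⊎ (d π φ i ≡ (∞ , ∞))
lemma2 π φ (suc j) (s≤s z≤n) = admissible-cases (d-admissible π φ j)
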